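{- A disconnected finite poset $P$ is LE-symmetric if and only if $P=C_{n_1}+A_1$ for some positive integer $n_1$, i.e. $P$ is the disjoint union of a chain and a single element.
   Context: For a finite poset $P$ with $n$ elements, a linear extension is a list $(p_1,\dots,p_n)$ of all elements of $P$ such that $p_a<_P p_b$ implies $a<b$; ${\mathcal{L}}(P)$ is the set of these. For $1\le i\le n-1$, the Bender--Knuth move $t_i$ acts on ${\mathcal{L}}(P)$ by swapping $p_i,p_{i+1}$ if they are incomparable and fixing the list otherwise. $\mathcal{BK}_P$ is the subgroup of the symmetric group ${\mathfrak{S}}_{{\mathcal{L}}(P)}$ generated by $t_1,\dots,t_{n-1}$. $P$ is LE-symmetric if $\mathcal{BK}_P={\mathfrak{S}}_{{\mathcal{L}}(P)}$. $C_m$ denotes an $m$-element chain, $A_1$ a one-element poset, and $+$ disjoint union of posets. -}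

module Defs where

open import Level using (0ℓ)
open import Data.Nat using (ℕ; zero; suc; _≤_; _<_)
open import Data.Fin using (Fin; toℕ)
open import Data.Vec using (Vec; []; _∷_; lookup)
open import Data.Vec.Membership.Propositional using (_∈_)
open import Data.List using (List; []; _∷_)
open import Data.List.Relation.Unary.All using (All)
open import Data.Bool using (Bool; true; false)
open import Data.Product using (Σ; ∃; _×_; _,_; proj₁)
open import Data.Sum using (_⊎_)
open import Relation.Nullary using (¬_; yes; no)
open import Relation.Binary using (Rel; Decidable)
open import Relation.Binary.PropositionalEquality using (_≡_; _≢_)
open import Function.Bundles using (_↔_; _⇔_; Inverse)

-- A finite poset on the ground set Fin n is given by a relation _≼_ on Fin n
-- (which will be assumed to be a decidable partial order w.r.t. _≡_).

module _ {n : ℕ} (_≼_ : Rel (Fin n) 0ℓ) where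

  _≺_ : Rel (Fin n) 0ℓ
  x ≺ y = (x ≼ y) × (x ≢ y)

  -- a linear extension: a list (p_1,...,p_n) containing every element of P
  -- (hence each exactly once) with p_a <_P p_b  ⇒  a < b
  IsLinExt : Vec (Fin n) n → Set
  IsLinExt v = (∀ x → x ∈ v)
             × (∀ a b → lookup v a ≺ lookup v b → toℕ a < toℕ b)

  LinExt : Set
  LinExt = Σ (Vec (Fin n) n) IsLinExt

  -- permutations of the set L(P) (elements compared by their underlying list)
  record PermLE : Set where
    field
      to   : LinExt → LinExt
      from : LinExt → LinExt
      to-cong   : ∀ u v → proj₁ u ≡ proj₁ v → proj₁ (to u) ≡ proj₁ (to v)
      from-cong : ∀ u v → proj₁ u ≡ proj₁ v → proj₁ (from u) ≡ proj₁ (from v)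
      to-from   : ∀ v → proj₁ (to (from v)) ≡ proj₁ v
      from-to   : ∀ v → proj₁ (from (to v)) ≡ proj₁ v

  Disconnected : Set
  Disconnected = Σ (Fin n → Bool) λ S →
      (∃ λ x → S x ≡ true) × (∃ λ y → S y ≡ false)
    × (∀ x y → S x ≡ true → S y ≡ false → ¬ (x ≼ y) × ¬ (y ≼ x))

module _ {n : ℕ} {_≼_ : Rel (Fin n) 0ℓ} (_≼?_ : Decidable _≼_) where

  -- Bender–Knuth move on raw lists: bk i is t_{i+1}, i.e. it swaps the entries in
  -- (0-based) positions i and i+1 if they are incomparable, and fixes the list otherwise
  bk : {m : ℕ} → ℕ → Vec (Fin n) m → Vec (Fin n) m
  bk zero (x ∷ y ∷ xs) with x ≼? y | y ≼? x
  ... | yes _ | _     = x ∷ y ∷ xs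
  ... | no _  | yes _ = x ∷ y ∷ xs
  ... | no _  | no _  = y ∷ x ∷ xs
  bk zero (x ∷ []) = x ∷ []
  bk zero []       = []
  bk (suc i) []       = []
  bk (suc i) (x ∷ xs) = x ∷ bk i xs

  applyWord : List ℕ → Vec (Fin n) n → Vec (Fin n) n
  applyWord []       v = v
  applyWord (i ∷ is) v = bk i (applyWord is v)

  -- BK_P = S_{L(P)}: every permutation of L(P) is a product of the t_i
  -- (each t_i is an involution, so the generated group consists of such words)
  LESymmetric : Set
  LESymmetric = (σ : PermLE _≼_) → Σ (List ℕ) λ w →
      All (λ i → suc i < n) w
    × (∀ v → applyWord w (proj₁ v) ≡ proj₁ (PermLE.to σ v))

-- the poset C_m + A_1 on Fin (suc m): elements 0..m-1 form a chain in the
-- natural order, element m is incomparable to all others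
ChainPlusPoint : (m : ℕ) → Rel (Fin (suc m)) 0ℓ
ChainPlusPoint m x y = (x ≡ y) ⊎ ((toℕ x ≤ toℕ y) × (toℕ y < m))

IsChainPlusPoint : {n : ℕ} → Rel (Fin n) 0ℓ → Set
IsChainPlusPoint {n} _≼_ = Σ ℕ λ m → (1 ≤ m) × Σ (Fin n ↔ Fin (suc m)) λ e →
  ∀ x y → (x ≼ y) ⇔ ChainPlusPoint m (Inverse.to e x) (Inverse.to e y)

-- Let P = Q + R be disconnected and record, for a linear extension, the side pattern saying
-- which entries lie in Q. Comparable neighbours lie on the same side, so a Bender–Knuth move
-- t_i acts on side patterns as the swap of positions i and i+1, and preserves the Hamming
-- distance between two patterns. If the t_i generate all permutations of L(P), then the
-- transposition exchanging X and W and fixing Y is a product of them, forcing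
-- d(X, Y) = d(W, Y). Start from a linear extension X₀ whose pattern is sorted (Q first).
-- Two incomparable neighbours on one side would give Y = t_k X₀ ≠ X₀ with the pattern of
-- X₀, against W = t_j X₀ at the side boundary; so both sides are chains. A block 1100 in the
-- pattern would give distances 2 and 4; so one side is a single point.
-- Conversely, a linear extension of C_m + A_1 is determined by the position of the isolated
-- point, on which the t_i act as the adjacent transpositions, and these generate the
-- symmetric group.

module Submission where

open import Defs
open import Level using (0ℓ)
open import Data.Nat using (ℕ; zero; suc; _+_; _∸_; _≤_; _<_; z≤n; s≤s)
import Data.Nat.Properties as ℕ
open import Data.Fin using (Fin; zero; suc; toℕ; fromℕ; fromℕ<; inject₁; lower₁; punchOut)
import Data.Fin.Properties as Fin
open import Data.Vec using (Vec; []; _∷_; lookup; map; tabulate; allFin)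
import Data.Vec.Properties as Vec
open import Data.Vec.Membership.Propositional using (_∈_)
open import Data.Vec.Membership.Propositional.Properties using (∈-allFin⁺; ∈-lookup; ∈-tabulate⁺)
open import Data.Vec.Relation.Unary.Any as Any using (Any; here; there)
open import Data.Vec.Relation.Unary.Any.Properties using (lookup-index; map⁺)
open import Data.Vec.Relation.Unary.All as All using (All; []; _∷_)
open import Data.Vec.Relation.Unary.All.Properties using (lookup⁺; lookup⁻)
open import Data.Bool using (Bool; true; false; not)
import Data.Bool.Properties as Bool
open import Data.List as List using (List; []; _∷_; _++_; _∷ʳ_; foldr; reverse)
open import Data.List.Properties using (foldr-++; foldr-∷ʳ; unfold-reverse; reverse-involutive)
import Data.List.Relation.Unary.All as ListAll
open import Data.List.Relation.Unary.All.Properties using (++⁺; ∷ʳ⁺)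
open import Data.Product using (Σ; ∃; ∃₂; _×_; _,_; proj₁; proj₂; swap)
open import Data.Sum as Sum using (_⊎_; inj₁; inj₂)
open import Data.Empty using (⊥-elim)
open import Data.Unit using (⊤; tt)
open import Function using (_∘_)
open import Function.Bundles using (_↔_; _⇔_; Inverse; Injection; Equivalence; mk↔ₛ′; mk⇔)
open import Function.Properties.Inverse using (↔⇒↣; ↔-sym)
open import Function.Definitions using (Injective; StrictlyInverseˡ; StrictlyInverseʳ)
open import Relation.Nullary using (¬_; yes; no; Dec)
open import Relation.Nullary.Decidable using (¬?; _×-dec_)
open import Relation.Binary using (Rel; Decidable; IsPartialOrder)
open import Relation.Binary.PropositionalEquality
  using (_≡_; _≢_; refl; sym; trans; cong; cong₂; subst; subst₂; module ≡-Reasoning)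

missed⇒¬injective : {n : ℕ} (g : Fin n → Fin n) (k : Fin n) → (∀ x → g x ≢ k) → ¬ Injective _≡_ _≡_ g
missed⇒¬injective {suc n} g k missed g-inj = ℕ.<-irrefl refl (Fin.injective⇒≤ h-inj)
  where
  h : Fin (suc n) → Fin n
  h x = punchOut (missed x ∘ sym)
  h-inj : Injective _≡_ _≡_ h
  h-inj {x} {y} eq = g-inj (Fin.punchOut-injective (missed x ∘ sym) (missed y ∘ sym) eq)

section⇒injective : {n : ℕ} (f g : Fin n → Fin n) → StrictlyInverseˡ _≡_ f g → Injective _≡_ _≡_ f
section⇒injective f g fg {i} {j} fi≡fj with i Fin.≟ j
... | yes i≡j = i≡j
... | no i≢j = ⊥-elim (missed⇒¬injective g (proj₁ missed) (proj₂ missed) g-inj)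
  where
  g-inj : Injective _≡_ _≡_ g
  g-inj {x} {y} gx≡gy = trans (sym (fg x)) (trans (cong f gx≡gy) (fg y))
  missed : ∃ λ k → ∀ x → g x ≢ k
  missed with g (f i) Fin.≟ i
  ... | yes gfi≡i = j , λ x gx≡j → i≢j (begin
    i           ≡⟨ sym gfi≡i ⟩
    g (f i)     ≡⟨ cong g (trans fi≡fj (cong f (sym gx≡j))) ⟩
    g (f (g x)) ≡⟨ cong g (fg x) ⟩
    g x         ≡⟨ gx≡j ⟩
    j           ∎)
    where open ≡-Reasoning
  ... | no gfi≢i = i , λ x gx≡i → gfi≢i (trans (cong g (trans (cong f (sym gx≡i)) (fg x))) gx≡i)

distinct⇒1≤n : ∀ {n} (x y : Fin (suc n)) → x ≢ y → 1 ≤ n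
distinct⇒1≤n {zero}  zero zero x≢y = ⊥-elim (x≢y refl)
distinct⇒1≤n {suc n} _    _    _   = s≤s z≤n

distinct-pair : ∀ {n} → 2 ≤ n → Σ (Fin n) λ a → Σ (Fin n) λ b → a ≢ b
distinct-pair {suc zero}    (s≤s ())
distinct-pair {suc (suc n)} _ = zero , suc zero , λ ()

module _ {X : Set} (act : ℕ → X → X) (act-involutive : ∀ i x → act i (act i x) ≡ x) where

  foldr-reverse-cancel : ∀ w x → foldr act (foldr act x w) (reverse w) ≡ x
  foldr-reverse-cancel []      x = refl
  foldr-reverse-cancel (i ∷ w) x = begin
    foldr act (act i (foldr act x w)) (reverse (i ∷ w))   ≡⟨ cong (foldr act _) (unfold-reverse i w) ⟩
    foldr act (act i (foldr act x w)) (reverse w ∷ʳ i)    ≡⟨ foldr-∷ʳ act _ i (reverse w) ⟩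
    foldr act (act i (act i (foldr act x w))) (reverse w) ≡⟨ cong (λ y → foldr act y (reverse w)) (act-involutive i _) ⟩
    foldr act (foldr act x w) (reverse w)                 ≡⟨ foldr-reverse-cancel w x ⟩
    x                                                     ∎
    where open ≡-Reasoning

  foldr-cancel-reverse : ∀ w x → foldr act (foldr act x (reverse w)) w ≡ x
  foldr-cancel-reverse w x =
    subst (λ w′ → foldr act (foldr act x (reverse w)) w′ ≡ x) (reverse-involutive w)
      (foldr-reverse-cancel (reverse w) x)

-- Adjacent swaps and Hamming distance of side patterns

swapAt : {A : Set} {k : ℕ} → ℕ → Vec A k → Vec A k
swapAt zero    (x ∷ y ∷ xs) = y ∷ x ∷ xs
swapAt zero    (x ∷ [])     = x ∷ []
swapAt zero    []           = []
swapAt (suc i) []           = []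
swapAt (suc i) (x ∷ xs)     = x ∷ swapAt i xs

swapAt-shift : {A : Set} {k : ℕ} (w : List ℕ) (x : A) (u : Vec A k) →
  foldr swapAt (x ∷ u) (List.map suc w) ≡ x ∷ foldr swapAt u w
swapAt-shift []      x u = refl
swapAt-shift (i ∷ w) x u = cong (swapAt (suc i)) (swapAt-shift w x u)

swapAt-lookup : {A : Set} {k : ℕ} (i : Fin k) (u : Vec A (suc k)) →
  lookup (swapAt (toℕ i) u) (inject₁ i) ≡ lookup u (suc i)
swapAt-lookup zero    (x ∷ y ∷ u) = refl
swapAt-lookup (suc i) (x ∷ u)     = swapAt-lookup i u

swapAt-idem : {A : Set} {k : ℕ} (i : Fin k) (u : Vec A (suc k)) →
  lookup u (inject₁ i) ≡ lookup u (suc i) → swapAt (toℕ i) u ≡ u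
swapAt-idem zero    (x ∷ y ∷ u) refl = refl
swapAt-idem (suc i) (x ∷ u)     eq   = cong (x ∷_) (swapAt-idem i u eq)

mismatch : Bool → Bool → ℕ
mismatch true  true  = 0
mismatch false false = 0
mismatch true  false = 1
mismatch false true  = 1

hamming : {k : ℕ} → Vec Bool k → Vec Bool k → ℕ
hamming []      []      = 0
hamming (b ∷ u) (c ∷ w) = mismatch b c + hamming u w

mismatch-refl : ∀ b → mismatch b b ≡ 0
mismatch-refl true  = refl
mismatch-refl false = refl

hamming-refl : {k : ℕ} (u : Vec Bool k) → hamming u u ≡ 0
hamming-refl []      = refl
hamming-refl (b ∷ u) rewrite mismatch-refl b = hamming-refl u

hamming-∷ : {k : ℕ} (b : Bool) (u w : Vec Bool k) → hamming (b ∷ u) (b ∷ w) ≡ hamming u w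
hamming-∷ b u w rewrite mismatch-refl b = refl

hamming≡0⇒≡ : {k : ℕ} (u w : Vec Bool k) → hamming u w ≡ 0 → u ≡ w
hamming≡0⇒≡ []          []          _  = refl
hamming≡0⇒≡ (true ∷ u)  (true ∷ w)  eq = cong (true ∷_) (hamming≡0⇒≡ u w eq)
hamming≡0⇒≡ (false ∷ u) (false ∷ w) eq = cong (false ∷_) (hamming≡0⇒≡ u w eq)

hamming-swapAt : {k : ℕ} (i : ℕ) (u w : Vec Bool k) → hamming (swapAt i u) (swapAt i w) ≡ hamming u w
hamming-swapAt zero    (a ∷ b ∷ u) (c ∷ d ∷ w) =
  trans (sym (ℕ.+-assoc (mismatch b d) _ _))
    (trans (cong (_+ hamming u w) (ℕ.+-comm (mismatch b d) _)) (ℕ.+-assoc (mismatch a c) _ _))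
hamming-swapAt zero    (a ∷ [])    (c ∷ [])    = refl
hamming-swapAt zero    []          []          = refl
hamming-swapAt (suc i) []          []          = refl
hamming-swapAt (suc i) (a ∷ u)     (c ∷ w)     = cong (mismatch a c +_) (hamming-swapAt i u w)

hamming-swapsAt : {k : ℕ} (w : List ℕ) (u u′ : Vec Bool k) →
  hamming (foldr swapAt u w) (foldr swapAt u′ w) ≡ hamming u u′
hamming-swapsAt []      u u′ = refl
hamming-swapsAt (i ∷ w) u u′ = trans (hamming-swapAt i (foldr swapAt u w) (foldr swapAt u′ w)) (hamming-swapsAt w u u′)

data Sorted : {k : ℕ} → Vec Bool k → Set where
  falses : {k : ℕ} {u : Vec Bool k} → All (_≡ false) u → Sorted u
  true∷  : {k : ℕ} {u : Vec Bool k} → Sorted u → Sorted (true ∷ u)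

insert-false : {k : ℕ} (u : Vec Bool k) → Sorted u → ∃ λ w → Sorted (foldr swapAt (false ∷ u) w)
insert-false u          (falses fs) = [] , falses (refl ∷ fs)
insert-false (true ∷ u) (true∷ s)   with insert-false u s
... | w , s′ = List.map suc w ∷ʳ 0 , subst Sorted (sym moved) (true∷ s′)
  where
  moved : foldr swapAt (false ∷ true ∷ u) (List.map suc w ∷ʳ 0) ≡ true ∷ foldr swapAt (false ∷ u) w
  moved = trans (foldr-∷ʳ swapAt _ 0 (List.map suc w)) (swapAt-shift w true (false ∷ u))

sort-by-swaps : {k : ℕ} (u : Vec Bool k) → ∃ λ w → Sorted (foldr swapAt u w)
sort-by-swaps [] = [] , falses []
sort-by-swaps (true ∷ u) with sort-by-swaps u
... | w , s = List.map suc w , subst Sorted (sym (swapAt-shift w true u)) (true∷ s)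
sort-by-swaps (false ∷ u) with sort-by-swaps u
... | w , s with insert-false (foldr swapAt u w) s
...   | w′ , s′ = w′ ++ List.map suc w , subst Sorted (sym moved) s′
  where
  moved : foldr swapAt (false ∷ u) (w′ ++ List.map suc w) ≡ foldr swapAt (false ∷ foldr swapAt u w) w′
  moved = trans (foldr-++ swapAt _ w′ (List.map suc w)) (cong (λ y → foldr swapAt y w′) (swapAt-shift w false u))

data Has1100At : ℕ → {k : ℕ} → Vec Bool k → Set where
  here  : {k : ℕ} {u : Vec Bool k} → Has1100At 0 (true ∷ true ∷ false ∷ false ∷ u)
  there : {i k : ℕ} {b : Bool} {u : Vec Bool k} → Has1100At i u → Has1100At (suc i) (b ∷ u)

hamming-1100-1010 : {i k : ℕ} {u : Vec Bool k} → Has1100At i u → hamming u (swapAt (suc i) u) ≡ 2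
hamming-1100-1010 (here {u = r})            = cong (2 +_) (hamming-refl r)
hamming-1100-1010 (there {b = b} {u = u} h) = trans (hamming-∷ b u _) (hamming-1100-1010 h)

hamming-0101-1010 : {i k : ℕ} {u : Vec Bool k} → Has1100At i u →
  hamming (swapAt i (swapAt (suc (suc i)) (swapAt (suc i) u))) (swapAt (suc i) u) ≡ 4
hamming-0101-1010 (here {u = r}) = cong (4 +_) (hamming-refl r)
hamming-0101-1010 (there {i = i} {b = b} {u = u} h) =
  trans (hamming-∷ b (swapAt i (swapAt (suc (suc i)) (swapAt (suc i) u))) _) (hamming-0101-1010 h)

data SortedShape {m : ℕ} (p : Vec Bool (suc m)) : Set where
  trues-then-false : (∀ k → lookup p (inject₁ k) ≡ true) → lookup p (fromℕ m) ≡ false → SortedShape p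
  true-then-falses : (∀ k → lookup p (suc k) ≡ false) → 2 ≤ m → SortedShape p
  has-1100         : (i : ℕ) → Has1100At i p → SortedShape p

private
  true∷-shape : {m : ℕ} (q : Vec Bool m) → Sorted q → Any (_≡ false) q → SortedShape (true ∷ q)
  true∷-shape (c ∷ [])     (falses (f ∷ [])) _ = trues-then-false (λ { zero → refl }) f
  true∷-shape (c ∷ d ∷ q)  (falses fs)       _ = true-then-falses (lookup⁺ fs) (s≤s (s≤s z≤n))
  true∷-shape (true ∷ q)   (true∷ s)         (there f) with true∷-shape q s f
  ... | trues-then-false ts f′ = trues-then-false (λ { zero → refl ; (suc k) → ts k }) f′
  ... | has-1100 i h           = has-1100 (suc i) (there h)
  ... | true-then-falses fs (s≤s (s≤s _)) with q | fs zero | fs (suc zero)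
  ...   | _ ∷ _ ∷ _ | refl | refl = has-1100 0 here

sortedShape : {m : ℕ} (p : Vec Bool (suc m)) → Sorted p → Any (_≡ true) p → Any (_≡ false) p → SortedShape p
sortedShape p          (falses fs) t _         =
  let x≡false , x≡true = All.lookupAny fs t in ⊥-elim (Bool.not-¬ x≡true x≡false)
sortedShape (true ∷ q) (true∷ s)   _ (there f) = true∷-shape q s f

nonconstant⇒adjacent-≢ : {m : ℕ} (u : Vec Bool (suc m)) → Any (_≡ true) u → Any (_≡ false) u →
  ∃ λ (k : Fin m) → lookup u (inject₁ k) ≢ lookup u (suc k)
nonconstant⇒adjacent-≢ (a ∷ [])     (here refl) (here ())
nonconstant⇒adjacent-≢ (a ∷ b ∷ u) t f with a Bool.≟ b
... | no a≢b = zero , a≢b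
... | yes refl with nonconstant⇒adjacent-≢ (a ∷ u) (drop-repeat t) (drop-repeat f)
  where
  drop-repeat : {P : Bool → Set} → Any P (a ∷ a ∷ u) → Any P (a ∷ u)
  drop-repeat (here p)  = here p
  drop-repeat (there q) = q
...   | k , differ = suc k , differ

-- Adjacent transpositions generate all permutations of positions

adjTranspose : {k : ℕ} → ℕ → Fin k → Fin k
adjTranspose {suc (suc k)} zero    zero          = suc zero
adjTranspose {suc zero}    zero    zero          = zero
adjTranspose               zero    (suc zero)    = zero
adjTranspose               zero    (suc (suc p)) = suc (suc p)
adjTranspose               (suc i) zero          = zero
adjTranspose               (suc i) (suc p)       = suc (adjTranspose i p)

adjTranspose-involutive : ∀ {k} i (p : Fin k) → adjTranspose i (adjTranspose i p) ≡ p
adjTranspose-involutive {suc (suc k)} zero    zero          = refl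
adjTranspose-involutive {suc zero}    zero    zero          = refl
adjTranspose-involutive               zero    (suc zero)    = refl
adjTranspose-involutive               zero    (suc (suc p)) = refl
adjTranspose-involutive               (suc i) zero          = refl
adjTranspose-involutive               (suc i) (suc p)       = cong suc (adjTranspose-involutive i p)

adjTranspose-fix : ∀ {k} i (p : Fin k) → toℕ p ≢ i → toℕ p ≢ suc i → adjTranspose i p ≡ p
adjTranspose-fix zero    zero          p≢0 _    = ⊥-elim (p≢0 refl)
adjTranspose-fix zero    (suc zero)    _   p≢1  = ⊥-elim (p≢1 refl)
adjTranspose-fix zero    (suc (suc p)) _   _    = refl
adjTranspose-fix (suc i) zero          _   _    = refl
adjTranspose-fix (suc i) (suc p)       ≢i  ≢1+i = cong suc (adjTranspose-fix i p (≢i ∘ cong suc) (≢1+i ∘ cong suc))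

adjTranspose-up : ∀ {k} (p : Fin k) → suc (toℕ p) < k → toℕ (adjTranspose (toℕ p) p) ≡ suc (toℕ p)
adjTranspose-up {suc (suc k)} zero    _         = refl
adjTranspose-up {suc zero}    zero    (s≤s ())
adjTranspose-up               (suc p) (s≤s lt) = cong suc (adjTranspose-up p lt)

bubble : ℕ → ℕ → List ℕ
bubble zero    j = []
bubble (suc t) j = bubble t (suc j) ∷ʳ j

bubble-moves : ∀ {k} t (p : Fin k) → toℕ p + t < k → toℕ (foldr adjTranspose p (bubble t (toℕ p))) ≡ toℕ p + t
bubble-moves zero        p _  = sym (ℕ.+-identityʳ (toℕ p))
bubble-moves {k} (suc t) p lt = begin
  toℕ (foldr adjTranspose p (bubble t (suc (toℕ p)) ∷ʳ toℕ p))
    ≡⟨ cong toℕ (foldr-∷ʳ adjTranspose p (toℕ p) (bubble t (suc (toℕ p)))) ⟩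
  toℕ (foldr adjTranspose p′ (bubble t (suc (toℕ p))))
    ≡⟨ cong (λ j → toℕ (foldr adjTranspose p′ (bubble t j))) (sym p′-up) ⟩
  toℕ (foldr adjTranspose p′ (bubble t (toℕ p′)))
    ≡⟨ bubble-moves t p′ (subst (λ x → x + t < k) (sym p′-up) lt′) ⟩
  toℕ p′ + t
    ≡⟨ cong (_+ t) p′-up ⟩
  suc (toℕ p) + t
    ≡⟨ sym (ℕ.+-suc (toℕ p) t) ⟩
  toℕ p + suc t ∎
  where
  open ≡-Reasoning
  lt′ : suc (toℕ p) + t < k
  lt′ = subst (_< k) (ℕ.+-suc (toℕ p) t) lt
  p′ = adjTranspose (toℕ p) p
  p′-up : toℕ p′ ≡ suc (toℕ p)
  p′-up = adjTranspose-up p (ℕ.≤-<-trans (ℕ.m≤m+n (suc (toℕ p)) t) lt′)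

bubble-fixes : ∀ {k} t j (p : Fin k) → j + t < toℕ p → foldr adjTranspose p (bubble t j) ≡ p
bubble-fixes zero    j p _  = refl
bubble-fixes (suc t) j p lt = begin
  foldr adjTranspose p (bubble t (suc j) ∷ʳ j)
    ≡⟨ foldr-∷ʳ adjTranspose p j (bubble t (suc j)) ⟩
  foldr adjTranspose (adjTranspose j p) (bubble t (suc j))
    ≡⟨ cong (λ p′ → foldr adjTranspose p′ (bubble t (suc j))) p-fixed ⟩
  foldr adjTranspose p (bubble t (suc j))
    ≡⟨ bubble-fixes t (suc j) p lt′ ⟩
  p ∎
  where
  open ≡-Reasoning
  lt′ : suc j + t < toℕ p
  lt′ = subst (_< toℕ p) (ℕ.+-suc j t) lt
  p-fixed : adjTranspose j p ≡ p
  p-fixed = adjTranspose-fix j p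
    (λ p≡j → ℕ.<-irrefl (sym p≡j) (ℕ.≤-<-trans (ℕ.m≤m+n j (suc t)) lt))
    (λ p≡1+j → ℕ.<-irrefl (sym p≡1+j) (ℕ.≤-<-trans (ℕ.m≤m+n (suc j) t) lt′))

bubble-bounded : ∀ m t j → j + t ≤ m → ListAll.All (λ i → suc i < suc m) (bubble t j)
bubble-bounded m zero    j _  = ListAll.[]
bubble-bounded m (suc t) j le = ∷ʳ⁺ (bubble-bounded m t (suc j) le′) (s≤s (ℕ.≤-trans (ℕ.m≤m+n (suc j) t) le′))
  where
  le′ : suc j + t ≤ m
  le′ = subst (_≤ m) (ℕ.+-suc j t) le

Adjacent-bounded : ℕ → List ℕ → Set
Adjacent-bounded m = ListAll.All (λ i → suc i < suc m)

bubble-to : ∀ {m} (a q : Fin (suc m)) → toℕ a ≤ toℕ q → ∃ λ C → Adjacent-bounded m C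
  × foldr adjTranspose a C ≡ q × (∀ (j : Fin (suc m)) → toℕ q < toℕ j → foldr adjTranspose j C ≡ j)
bubble-to {m} a q a≤q = bubble t (toℕ a) , bounded , moves , fixes
  where
  t = toℕ q ∸ toℕ a
  a+t≡q : toℕ a + t ≡ toℕ q
  a+t≡q = ℕ.m+[n∸m]≡n a≤q
  bounded : Adjacent-bounded m (bubble t (toℕ a))
  bounded = bubble-bounded m t (toℕ a) (subst (_≤ m) (sym a+t≡q) (Fin.toℕ≤pred[n] q))
  moves : foldr adjTranspose a (bubble t (toℕ a)) ≡ q
  moves = Fin.toℕ-injective (trans (bubble-moves t a (subst (_< suc m) (sym a+t≡q) (Fin.toℕ<n q))) a+t≡q)
  fixes : ∀ j → toℕ q < toℕ j → foldr adjTranspose j (bubble t (toℕ a)) ≡ j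
  fixes j q<j = bubble-fixes t (toℕ a) j (subst (_< toℕ j) (sym a+t≡q) q<j)

-- C bubbles π⁻¹(k) up to position k, so π ∘ C⁻¹ also fixes k.
fixing-above-step : ∀ {m} k (π π′ : Fin (suc m) → Fin (suc m)) → StrictlyInverseˡ _≡_ π π′ →
  (∀ j → suc k ≤ toℕ j → π j ≡ j) → k < suc m →
  ∃ λ C → Adjacent-bounded m C × (∀ j → k ≤ toℕ j → π (foldr adjTranspose j (reverse C)) ≡ j)
fixing-above-step {m} k π π′ ππ′ fixed k<1+m = C , C-bounded , fixed′
  where
  open ≡-Reasoning
  τ : ℕ → Fin (suc m) → Fin (suc m)
  τ = adjTranspose
  q : Fin (suc m)
  q = fromℕ< k<1+m
  q≡k : toℕ q ≡ k
  q≡k = Fin.toℕ-fromℕ< k<1+m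
  a = π′ q
  a≤q : toℕ a ≤ toℕ q
  a≤q = subst (toℕ a ≤_) (sym q≡k) (ℕ.≮⇒≥ λ k<a →
    ℕ.<-irrefl (trans (sym q≡k) (cong toℕ (trans (sym (ππ′ q)) (fixed a k<a)))) k<a)
  bubbled = bubble-to a q a≤q
  C = proj₁ bubbled
  C-bounded = proj₁ (proj₂ bubbled)
  C-moves = proj₁ (proj₂ (proj₂ bubbled))
  C-fixes = proj₂ (proj₂ (proj₂ bubbled))
  undo-C : ∀ j → π (foldr τ (foldr τ j C) (reverse C)) ≡ π j
  undo-C j = cong π (foldr-reverse-cancel τ adjTranspose-involutive C j)
  fixed′ : ∀ j → k ≤ toℕ j → π (foldr τ j (reverse C)) ≡ j
  fixed′ j k≤j with toℕ j ℕ.≟ k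
  ... | yes j≡k = begin
    π (foldr τ j (reverse C))                 ≡⟨ cong (λ x → π (foldr τ x (reverse C))) (trans j≡q (sym C-moves)) ⟩
    π (foldr τ (foldr τ a C) (reverse C))     ≡⟨ undo-C a ⟩
    π a                                       ≡⟨ ππ′ q ⟩
    q                                         ≡⟨ sym j≡q ⟩
    j                                         ∎
    where
    j≡q : j ≡ q
    j≡q = Fin.toℕ-injective (trans j≡k (sym q≡k))
  ... | no j≢k = begin
    π (foldr τ j (reverse C))                 ≡⟨ cong (λ x → π (foldr τ x (reverse C))) (sym (C-fixes j q<j)) ⟩
    π (foldr τ (foldr τ j C) (reverse C))     ≡⟨ undo-C j ⟩
    π j                                       ≡⟨ fixed j k<j ⟩
    j                                         ∎
    where
    k<j : k < toℕ j
    k<j = ℕ.≤∧≢⇒< k≤j (j≢k ∘ sym)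
    q<j : toℕ q < toℕ j
    q<j = subst (_< toℕ j) (sym q≡k) k<j

realize-fixing-above : ∀ {m} k (π π′ : Fin (suc m) → Fin (suc m)) →
  StrictlyInverseˡ _≡_ π π′ → StrictlyInverseʳ _≡_ π π′ → (∀ j → k ≤ toℕ j → π j ≡ j) →
  ∃ λ w → Adjacent-bounded m w × (∀ j → foldr adjTranspose j w ≡ π j)
realize-fixing-above zero π π′ _ _ fixed = [] , ListAll.[] , λ j → sym (fixed j z≤n)
realize-fixing-above {m} (suc k) π π′ ππ′ π′π fixed with k ℕ.<? suc m
... | no k≮1+m = realize-fixing-above k π π′ ππ′ π′π
                   (λ j k≤j → ⊥-elim (k≮1+m (ℕ.≤-<-trans k≤j (Fin.toℕ<n j))))
... | yes k<1+m with fixing-above-step k π π′ ππ′ fixed k<1+m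
...   | C , C-bounded , fixed′ with realize-fixing-above k π₂ π₂′ π₂π₂′ π₂′π₂ fixed′
  where
  τ : ℕ → Fin (suc m) → Fin (suc m)
  τ = adjTranspose
  π₂ π₂′ : Fin (suc m) → Fin (suc m)
  π₂ j = π (foldr τ j (reverse C))
  π₂′ j = foldr τ (π′ j) C
  π₂π₂′ : StrictlyInverseˡ _≡_ π₂ π₂′
  π₂π₂′ j = trans (cong π (foldr-reverse-cancel τ adjTranspose-involutive C (π′ j))) (ππ′ j)
  π₂′π₂ : StrictlyInverseʳ _≡_ π₂ π₂′
  π₂′π₂ j = trans (cong (λ x → foldr τ x C) (π′π _)) (foldr-cancel-reverse τ adjTranspose-involutive C j)
...     | w′ , w′-bounded , w′-realizes = w′ ++ C , ++⁺ w′-bounded C-bounded , λ j → begin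
    foldr adjTranspose j (w′ ++ C)
      ≡⟨ foldr-++ adjTranspose j w′ C ⟩
    foldr adjTranspose (foldr adjTranspose j C) w′
      ≡⟨ w′-realizes (foldr adjTranspose j C) ⟩
    π (foldr adjTranspose (foldr adjTranspose j C) (reverse C))
      ≡⟨ cong π (foldr-reverse-cancel adjTranspose adjTranspose-involutive C j) ⟩
    π j ∎
  where open ≡-Reasoning

adjTransposes-realize : ∀ {m} (π π′ : Fin (suc m) → Fin (suc m)) →
  StrictlyInverseˡ _≡_ π π′ → StrictlyInverseʳ _≡_ π π′ →
  ∃ λ w → Adjacent-bounded m w × (∀ j → foldr adjTranspose j w ≡ π j)
adjTransposes-realize {m} π π′ ππ′ π′π = realize-fixing-above (suc m) π π′ ππ′ π′π
  (λ j 1+m≤j → ⊥-elim (ℕ.<-irrefl refl (ℕ.<-≤-trans (Fin.toℕ<n j) 1+m≤j)))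

module _ {n : ℕ} (f : Fin (suc n) → Fin (suc n))
         (f-increasing : ∀ i j → toℕ i < toℕ j → toℕ (f i) < toℕ (f j)) where

  private
    at-least : ∀ t i → toℕ i ≡ t → t ≤ toℕ (f i)
    at-least zero    i        _  = z≤n
    at-least (suc t) (suc i) i≡t =
      ℕ.≤-<-trans (at-least t (inject₁ i) i′≡t) (f-increasing (inject₁ i) (suc i) i′<1+i)
      where
      i′≡t : toℕ (inject₁ i) ≡ t
      i′≡t = trans (Fin.toℕ-inject₁ i) (ℕ.suc-injective i≡t)
      i′<1+i : toℕ (inject₁ i) < suc (toℕ i)
      i′<1+i = s≤s (ℕ.≤-reflexive (Fin.toℕ-inject₁ i))

    at-most : ∀ t i → toℕ i + t ≡ n → toℕ (f i) + t ≤ n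
    at-most zero    i _     = subst (_≤ n) (sym (ℕ.+-identityʳ _)) (Fin.toℕ≤pred[n] (f i))
    at-most (suc t) i i+t≡n = subst (_≤ n) (sym (ℕ.+-suc (toℕ (f i)) t))
                                (ℕ.≤-trans (ℕ.+-monoˡ-≤ t (f-increasing i j i<j)) (at-most t j j+t≡n))
      where
      i<n : toℕ i < n
      i<n = subst (toℕ i <_) i+t≡n (subst (suc (toℕ i) ≤_) (sym (ℕ.+-suc (toℕ i) t)) (s≤s (ℕ.m≤m+n (toℕ i) t)))
      j : Fin (suc n)
      j = fromℕ< (s≤s i<n)
      j≡1+i : toℕ j ≡ suc (toℕ i)
      j≡1+i = Fin.toℕ-fromℕ< (s≤s i<n)
      i<j : toℕ i < toℕ j
      i<j = ℕ.≤-reflexive (sym j≡1+i)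
      j+t≡n : toℕ j + t ≡ n
      j+t≡n = trans (cong (_+ t) j≡1+i) (trans (sym (ℕ.+-suc (toℕ i) t)) i+t≡n)

  strictlyIncreasing⇒≗id : ∀ i → f i ≡ i
  strictlyIncreasing⇒≗id i = Fin.toℕ-injective (ℕ.≤-antisym fi≤i (at-least (toℕ i) i refl))
    where
    i+d≡n : toℕ i + (n ∸ toℕ i) ≡ n
    i+d≡n = ℕ.m+[n∸m]≡n (Fin.toℕ≤pred[n] i)
    fi≤i : toℕ (f i) ≤ toℕ i
    fi≤i = ℕ.+-cancelʳ-≤ (n ∸ toℕ i) (toℕ (f i)) (toℕ i)
             (subst (toℕ (f i) + (n ∸ toℕ i) ≤_) (sym i+d≡n) (at-most (n ∸ toℕ i) i i+d≡n))

-- Bender–Knuth moves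

module BenderKnuth {N : ℕ} (_≼_ : Rel (Fin N) 0ℓ) (po : IsPartialOrder _≡_ _≼_) (_≼?_ : Decidable _≼_) where

  open IsPartialOrder po using (antisym) renaming (trans to ≼-trans; reflexive to ≼-reflexive)

  _⊏_ : Rel (Fin N) 0ℓ
  _⊏_ = _≺_ _≼_

  ⊏-irrefl : ∀ {x} → ¬ (x ⊏ x)
  ⊏-irrefl (_ , x≢x) = x≢x refl

  ⊏-trans : ∀ {x y z} → x ⊏ y → y ⊏ z → x ⊏ z
  ⊏-trans (x≼y , x≢y) (y≼z , y≢z) = ≼-trans x≼y y≼z , λ x≡z → y≢z (antisym y≼z (subst (_≼ _) x≡z x≼y))

  Incomparable Comparable : Fin N → Fin N → Set
  Incomparable x y = ¬ (x ≼ y) × ¬ (y ≼ x)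
  Comparable   x y = (x ≼ y) ⊎ (y ≼ x)

  incomparable⊎comparable : ∀ x y → Incomparable x y ⊎ Comparable x y
  incomparable⊎comparable x y with x ≼? y | y ≼? x
  ... | yes x≼y | _       = inj₂ (inj₁ x≼y)
  ... | no _    | yes y≼x = inj₂ (inj₂ y≼x)
  ... | no x⋠y  | no y⋠x  = inj₁ (x⋠y , y⋠x)

  t : {k : ℕ} → ℕ → Vec (Fin N) k → Vec (Fin N) k
  t = bk _≼?_

  t-incomparable : ∀ {k x y} {xs : Vec (Fin N) k} → Incomparable x y → t zero (x ∷ y ∷ xs) ≡ y ∷ x ∷ xs
  t-incomparable {x = x} {y} (x⋠y , y⋠x) with x ≼? y | y ≼? x
  ... | yes x≼y | _       = ⊥-elim (x⋠y x≼y)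
  ... | no _    | yes y≼x = ⊥-elim (y⋠x y≼x)
  ... | no _    | no _    = refl

  t-comparable : ∀ {k x y} {xs : Vec (Fin N) k} → Comparable x y → t zero (x ∷ y ∷ xs) ≡ x ∷ y ∷ xs
  t-comparable {x = x} {y} x∼y with x ≼? y | y ≼? x | x∼y
  ... | yes _ | _     | _        = refl
  ... | no _  | yes _ | _        = refl
  ... | no x⋠y | no _ | inj₁ x≼y = ⊥-elim (x⋠y x≼y)
  ... | no _ | no y⋠x | inj₂ y≼x = ⊥-elim (y⋠x y≼x)

  t-involutive : ∀ {k} i (v : Vec (Fin N) k) → t i (t i v) ≡ v
  t-involutive zero (x ∷ y ∷ xs) with incomparable⊎comparable x y
  ... | inj₁ (x⋠y , y⋠x) rewrite t-incomparable {xs = xs} (x⋠y , y⋠x) | t-incomparable {xs = xs} (y⋠x , x⋠y) = refl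
  ... | inj₂ x∼y         rewrite t-comparable {xs = xs} x∼y | t-comparable {xs = xs} x∼y = refl
  t-involutive zero    (x ∷ []) = refl
  t-involutive zero    []       = refl
  t-involutive (suc i) []       = refl
  t-involutive (suc i) (x ∷ xs) = cong (x ∷_) (t-involutive i xs)

  t-lookup-incomparable : ∀ {k} (i : Fin k) (v : Vec (Fin N) (suc k)) →
    Incomparable (lookup v (inject₁ i)) (lookup v (suc i)) → lookup (t (toℕ i) v) (inject₁ i) ≡ lookup v (suc i)
  t-lookup-incomparable zero    (x ∷ y ∷ xs) x∥y rewrite t-incomparable {xs = xs} x∥y = refl
  t-lookup-incomparable (suc i) (x ∷ v)      x∥y = t-lookup-incomparable i v x∥y

  t-∈ : ∀ {k y} i (v : Vec (Fin N) k) → y ∈ v → y ∈ t i v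
  t-∈ zero (x ∷ y ∷ xs) y∈ with incomparable⊎comparable x y
  ... | inj₂ x∼y rewrite t-comparable {xs = xs} x∼y = y∈
  ... | inj₁ x∥y rewrite t-incomparable {xs = xs} x∥y with y∈
  ...   | here p          = there (here p)
  ...   | there (here p)  = here p
  ...   | there (there p) = there (there p)
  t-∈ zero    (x ∷ [])  y∈         = y∈
  t-∈ (suc i) (x ∷ xs) (here p)  = here p
  t-∈ (suc i) (x ∷ xs) (there p) = there (t-∈ i xs p)

  t-∈⁻ : ∀ {k y} i (v : Vec (Fin N) k) → y ∈ t i v → y ∈ v
  t-∈⁻ {y = y} i v y∈ = subst (y ∈_) (t-involutive i v) (t-∈ i (t i v) y∈)

  t-All : ∀ {k} {P : Fin N → Set} i (v : Vec (Fin N) k) → All P v → All P (t i v)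
  t-All i v all = lookup⁻ (λ a → All.lookup all (t-∈⁻ i v (∈-lookup a (t i v))))

  applyWord≡foldr : ∀ w (v : Vec (Fin N) N) → applyWord _≼?_ w v ≡ foldr t v w
  applyWord≡foldr []      v = refl
  applyWord≡foldr (i ∷ w) v = cong (t i) (applyWord≡foldr w v)

  applyWord-reverse-cancel : ∀ w (v : Vec (Fin N) N) → applyWord _≼?_ (reverse w) (applyWord _≼?_ w v) ≡ v
  applyWord-reverse-cancel w v = begin
    applyWord _≼?_ (reverse w) (applyWord _≼?_ w v) ≡⟨ applyWord≡foldr (reverse w) _ ⟩
    foldr t (applyWord _≼?_ w v) (reverse w)        ≡⟨ cong (λ u → foldr t u (reverse w)) (applyWord≡foldr w v) ⟩
    foldr t (foldr t v w) (reverse w)               ≡⟨ foldr-reverse-cancel t t-involutive w v ⟩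
    v                                               ∎
    where open ≡-Reasoning

  DescentFree : ∀ {k} → Vec (Fin N) k → Set
  DescentFree []       = ⊤
  DescentFree (x ∷ xs) = All (λ y → ¬ (y ⊏ x)) xs × DescentFree xs

  Respects : ∀ {k} → Vec (Fin N) k → Set
  Respects v = ∀ a b → lookup v a ⊏ lookup v b → toℕ a < toℕ b

  descentFree⇒respects : ∀ {k} (v : Vec (Fin N) k) → DescentFree v → Respects v
  descentFree⇒respects (x ∷ xs) _             zero    zero    x⊏x = ⊥-elim (⊏-irrefl x⊏x)
  descentFree⇒respects (x ∷ xs) _             zero    (suc b) _   = s≤s z≤n
  descentFree⇒respects (x ∷ xs) (above , _)   (suc a) zero    y⊏x = ⊥-elim (lookup⁺ above a y⊏x)
  descentFree⇒respects (x ∷ xs) (_ , xs-free) (suc a) (suc b) y⊏z = s≤s (descentFree⇒respects xs xs-free a b y⊏z)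

  respects⇒descentFree : ∀ {k} (v : Vec (Fin N) k) → Respects v → DescentFree v
  respects⇒descentFree []       _      = tt
  respects⇒descentFree (x ∷ xs) resp =
    lookup⁻ (λ a y⊏x → ℕ.<⇒≱ (resp (suc a) zero y⊏x) z≤n) ,
    respects⇒descentFree xs (λ a b y⊏z → ℕ.≤-pred (resp (suc a) (suc b) y⊏z))

  t-descentFree : ∀ {k} i (v : Vec (Fin N) k) → DescentFree v → DescentFree (t i v)
  t-descentFree zero (x ∷ y ∷ xs) (y⊀x ∷ x-above , y-above , xs-free) with incomparable⊎comparable x y
  ... | inj₁ x∥y rewrite t-incomparable {xs = xs} x∥y = (proj₁ x∥y ∘ proj₁) ∷ y-above , x-above , xs-free
  ... | inj₂ x∼y rewrite t-comparable {xs = xs} x∼y   = y⊀x ∷ x-above , y-above , xs-free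
  t-descentFree zero    (x ∷ [])  free           = free
  t-descentFree zero    []        free           = free
  t-descentFree (suc i) []        free           = free
  t-descentFree (suc i) (x ∷ xs) (above , free) = t-All i xs above , t-descentFree i xs free

  t-isLinExt : ∀ i (v : Vec (Fin N) N) → IsLinExt _≼_ v → IsLinExt _≼_ (t i v)
  t-isLinExt i v (all∈ , resp) =
    (λ x → t-∈ i v (all∈ x)) , descentFree⇒respects (t i v) (t-descentFree i v (respects⇒descentFree v resp))

  applyWord-isLinExt : ∀ w (v : Vec (Fin N) N) → IsLinExt _≼_ v → IsLinExt _≼_ (applyWord _≼?_ w v)
  applyWord-isLinExt []      v le = le
  applyWord-isLinExt (i ∷ w) v le = t-isLinExt i (applyWord _≼?_ w v) (applyWord-isLinExt w v le)

  act : List ℕ → LinExt _≼_ → LinExt _≼_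
  act w (v , le) = applyWord _≼?_ w v , applyWord-isLinExt w v le

  linExt-injective : (v : Vec (Fin N) N) → IsLinExt _≼_ v → Injective _≡_ _≡_ (lookup v)
  linExt-injective v (all∈ , _) =
    section⇒injective (lookup v) (λ x → Any.index (all∈ x)) (λ x → sym (lookup-index (all∈ x)))

  record MinimalSplit {k : ℕ} (xs : Vec (Fin N) (suc k)) : Set where
    field
      minimum   : Fin N
      rest      : Vec (Fin N) k
      minimum∈  : minimum ∈ xs
      rest⊆     : ∀ {y} → y ∈ rest → y ∈ xs
      covers    : ∀ {y} → y ∈ xs → y ≡ minimum ⊎ y ∈ rest
      isMinimal : ∀ {y} → y ∈ xs → ¬ (y ⊏ minimum)

  minimalSplit : ∀ {k} (xs : Vec (Fin N) (suc k)) → MinimalSplit xs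
  minimalSplit (x ∷ []) = record
    { minimum = x ; rest = [] ; minimum∈ = here refl ; rest⊆ = λ ()
    ; covers = λ { (here y≡x) → inj₁ y≡x } ; isMinimal = λ { (here refl) → ⊏-irrefl } }
  minimalSplit (x ∷ x′ ∷ xs) with minimalSplit (x′ ∷ xs)
  ... | s with (x ≼? MinimalSplit.minimum s) ×-dec ¬? (x Fin.≟ MinimalSplit.minimum s)
  ...   | yes x⊏m = record
    { minimum = x ; rest = minimum ∷ rest ; minimum∈ = here refl
    ; rest⊆ = λ { (here refl) → there minimum∈ ; (there y∈) → there (rest⊆ y∈) }
    ; covers = λ { (here y≡x) → inj₁ y≡x ; (there y∈) → inj₂ (Sum.[ here , there ] (covers y∈)) }
    ; isMinimal = λ { (here refl) → ⊏-irrefl ; (there y∈) y⊏x → isMinimal y∈ (⊏-trans y⊏x x⊏m) } }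
    where open MinimalSplit s
  ...   | no x⊀m = record
    { minimum = minimum ; rest = x ∷ rest ; minimum∈ = there minimum∈
    ; rest⊆ = λ { (here refl) → here refl ; (there y∈) → there (rest⊆ y∈) }
    ; covers = λ { (here y≡x) → inj₂ (here y≡x) ; (there y∈) → Sum.map₂ there (covers y∈) }
    ; isMinimal = λ { (here refl) → x⊀m ; (there y∈) → isMinimal y∈ } }
    where open MinimalSplit s

  topologicalSort : ∀ {k} (xs : Vec (Fin N) k) →
    Σ (Vec (Fin N) k) λ r → (∀ {y} → y ∈ xs → y ∈ r) × (∀ {y} → y ∈ r → y ∈ xs) × DescentFree r
  topologicalSort [] = [] , (λ ()) , (λ ()) , tt
  topologicalSort xs@(_ ∷ _) with minimalSplit xs
  ... | s with topologicalSort (MinimalSplit.rest s)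
  ...   | r , rest⊆r , r⊆rest , r-free =
    minimum ∷ r ,
    (λ y∈ → Sum.[ here , there ∘ rest⊆r ] (covers y∈)) ,
    (λ { (here refl) → minimum∈ ; (there y∈) → rest⊆ (r⊆rest y∈) }) ,
    lookup⁻ (λ a → isMinimal (rest⊆ (r⊆rest (∈-lookup a r)))) , r-free
    where open MinimalSplit s

  someLinExt : LinExt _≼_
  someLinExt with topologicalSort (allFin N)
  ... | r , all⊆r , _ , r-free = r , (λ x → all⊆r (∈-allFin⁺ x)) , descentFree⇒respects r r-free

  module Transposition (X W : LinExt _≼_) where

    private
      _≟ᵥ_ : (a b : Vec (Fin N) N) → Dec (a ≡ b)
      _≟ᵥ_ = Vec.≡-dec Fin._≟_

    swapXW : LinExt _≼_ → LinExt _≼_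
    swapXW v with proj₁ v ≟ᵥ proj₁ X | proj₁ v ≟ᵥ proj₁ W
    ... | yes _ | _     = W
    ... | no _  | yes _ = X
    ... | no _  | no _  = v

    swapXW-X : ∀ v → proj₁ v ≡ proj₁ X → proj₁ (swapXW v) ≡ proj₁ W
    swapXW-X v v≡X with proj₁ v ≟ᵥ proj₁ X
    ... | yes _  = refl
    ... | no v≢X = ⊥-elim (v≢X v≡X)

    swapXW-W : ∀ v → proj₁ v ≡ proj₁ W → proj₁ (swapXW v) ≡ proj₁ X
    swapXW-W v v≡W with proj₁ v ≟ᵥ proj₁ X | proj₁ v ≟ᵥ proj₁ W
    ... | yes v≡X | _      = trans (sym v≡W) v≡X
    ... | no _    | yes _  = refl
    ... | no _    | no v≢W = ⊥-elim (v≢W v≡W)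

    swapXW-other : ∀ v → proj₁ v ≢ proj₁ X → proj₁ v ≢ proj₁ W → proj₁ (swapXW v) ≡ proj₁ v
    swapXW-other v v≢X v≢W with proj₁ v ≟ᵥ proj₁ X | proj₁ v ≟ᵥ proj₁ W
    ... | yes v≡X | _       = ⊥-elim (v≢X v≡X)
    ... | no _    | yes v≡W = ⊥-elim (v≢W v≡W)
    ... | no _    | no _    = refl

    swapXW-cong : ∀ u v → proj₁ u ≡ proj₁ v → proj₁ (swapXW u) ≡ proj₁ (swapXW v)
    swapXW-cong u v u≡v with proj₁ u ≟ᵥ proj₁ X | proj₁ u ≟ᵥ proj₁ W
    ... | yes u≡X | _       = sym (swapXW-X v (trans (sym u≡v) u≡X))
    ... | no _    | yes u≡W = sym (swapXW-W v (trans (sym u≡v) u≡W))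
    ... | no u≢X  | no u≢W  = trans u≡v (sym (swapXW-other v (u≢X ∘ trans u≡v) (u≢W ∘ trans u≡v)))

    swapXW-involutive : ∀ v → proj₁ (swapXW (swapXW v)) ≡ proj₁ v
    swapXW-involutive v with proj₁ v ≟ᵥ proj₁ X | proj₁ v ≟ᵥ proj₁ W
    ... | yes v≡X | _       = trans (swapXW-W W refl) (sym v≡X)
    ... | no _    | yes v≡W = trans (swapXW-X X refl) (sym v≡W)
    ... | no v≢X  | no v≢W  = swapXW-other v v≢X v≢W

    transposition : PermLE _≼_
    transposition = record
      { to = swapXW ; from = swapXW ; to-cong = swapXW-cong ; from-cong = swapXW-cong
      ; to-from = swapXW-involutive ; from-to = swapXW-involutive }

-- A disconnected LE-symmetric poset is C_m + A_1

Separates : {N : ℕ} → Rel (Fin N) 0ℓ → (Fin N → Bool) → Set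
Separates _≼_ S = ∀ x y → S x ≡ true → S y ≡ false → ¬ (x ≼ y) × ¬ (y ≼ x)

separates-not : ∀ {N} {_≼_ : Rel (Fin N) 0ℓ} {S} → Separates _≼_ S → Separates _≼_ (not ∘ S)
separates-not {S = S} cross x y ¬Sx≡true ¬Sy≡false =
  swap (cross y x (Bool.not-injective ¬Sy≡false) (Bool.not-injective {y = false} ¬Sx≡true))

Lopsided : {N : ℕ} → (Fin N → Bool) → Set
Lopsided S = (∃ λ x → ∀ y → S y ≡ true → y ≡ x)
           × (∃₂ λ y₁ y₂ → y₁ ≢ y₂ × S y₁ ≡ false × S y₂ ≡ false)

module Sides {N : ℕ} (_≼_ : Rel (Fin N) 0ℓ) (po : IsPartialOrder _≡_ _≼_) (_≼?_ : Decidable _≼_)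
             (S : Fin N → Bool) (cross : Separates _≼_ S) where

  open BenderKnuth _≼_ po _≼?_

  differentSides⇒incomparable : ∀ x y → S x ≢ S y → Incomparable x y
  differentSides⇒incomparable x y Sx≢Sy with S x in Sx | S y in Sy
  ... | true  | true  = ⊥-elim (Sx≢Sy refl)
  ... | false | false = ⊥-elim (Sx≢Sy refl)
  ... | true  | false = cross x y Sx Sy
  ... | false | true  = swap (cross y x Sy Sx)

  comparable⇒sameSide : ∀ x y → Comparable x y → S x ≡ S y
  comparable⇒sameSide x y x∼y with S x Bool.≟ S y
  ... | yes Sx≡Sy = Sx≡Sy
  ... | no Sx≢Sy with differentSides⇒incomparable x y Sx≢Sy | x∼y
  ...   | x⋠y , _ | inj₁ x≼y = ⊥-elim (x⋠y x≼y)
  ...   | _ , y⋠x | inj₂ y≼x = ⊥-elim (y⋠x y≼x)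

  sides : ∀ {k} → Vec (Fin N) k → Vec Bool k
  sides = map S

  hamming≢0⇒≢ : ∀ {k} (a b : Vec (Fin N) k) → hamming (sides a) (sides b) ≢ 0 → a ≢ b
  hamming≢0⇒≢ a b ≢0 refl = ≢0 (hamming-refl (sides a))

  sides-t : ∀ {k} i (v : Vec (Fin N) k) → sides (t i v) ≡ swapAt i (sides v)
  sides-t zero (x ∷ y ∷ xs) with incomparable⊎comparable x y
  ... | inj₁ x∥y rewrite t-incomparable {xs = xs} x∥y = refl
  ... | inj₂ x∼y rewrite t-comparable {xs = xs} x∼y | comparable⇒sameSide x y x∼y = refl
  sides-t zero    (x ∷ [])  = refl
  sides-t zero    []        = refl
  sides-t (suc i) []        = refl
  sides-t (suc i) (x ∷ xs)  = cong (S x ∷_) (sides-t i xs)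

  sides-applyWord : ∀ w (v : Vec (Fin N) N) → sides (applyWord _≼?_ w v) ≡ foldr swapAt (sides v) w
  sides-applyWord []      v = refl
  sides-applyWord (i ∷ w) v = trans (sides-t i (applyWord _≼?_ w v)) (cong (swapAt i) (sides-applyWord w v))

  hamming-invariant : LESymmetric _≼?_ → (X Y W : LinExt _≼_) → proj₁ Y ≢ proj₁ X → proj₁ Y ≢ proj₁ W →
    hamming (sides (proj₁ X)) (sides (proj₁ Y)) ≡ hamming (sides (proj₁ W)) (sides (proj₁ Y))
  hamming-invariant les X Y W Y≢X Y≢W = begin
    hamming (sides (proj₁ X)) (sides (proj₁ Y))
      ≡⟨ sym (hamming-swapsAt w (sides (proj₁ X)) (sides (proj₁ Y))) ⟩
    hamming (foldr swapAt (sides (proj₁ X)) w) (foldr swapAt (sides (proj₁ Y)) w)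
      ≡⟨ sym (cong₂ hamming (sides-applyWord w (proj₁ X)) (sides-applyWord w (proj₁ Y))) ⟩
    hamming (sides (applyWord _≼?_ w (proj₁ X))) (sides (applyWord _≼?_ w (proj₁ Y)))
      ≡⟨ cong₂ (λ a b → hamming (sides a) (sides b)) w-maps-X w-fixes-Y ⟩
    hamming (sides (proj₁ W)) (sides (proj₁ Y)) ∎
    where
    open ≡-Reasoning
    open Transposition X W
    w = proj₁ (les transposition)
    w-realizes = proj₂ (proj₂ (les transposition))
    w-maps-X : applyWord _≼?_ w (proj₁ X) ≡ proj₁ W
    w-maps-X = trans (w-realizes X) (swapXW-X X refl)
    w-fixes-Y : applyWord _≼?_ w (proj₁ Y) ≡ proj₁ Y
    w-fixes-Y = trans (w-realizes Y) (swapXW-other Y Y≢X Y≢W)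

module SortedLinExt {m : ℕ} (_≼_ : Rel (Fin (suc m)) 0ℓ) (po : IsPartialOrder _≡_ _≼_) (_≼?_ : Decidable _≼_)
                    (S : Fin (suc m) → Bool) (cross : Separates _≼_ S)
                    (les : LESymmetric _≼?_)
                    (some-true : ∃ λ x → S x ≡ true) (some-false : ∃ λ y → S y ≡ false) where

  open BenderKnuth _≼_ po _≼?_
  open Sides _≼_ po _≼?_ S cross
  open IsPartialOrder po using () renaming (trans to ≼-trans; reflexive to ≼-reflexive)

  X₀ : LinExt _≼_
  X₀ = act (proj₁ (sort-by-swaps (sides (proj₁ someLinExt)))) someLinExt

  v : Vec (Fin (suc m)) (suc m)
  v = proj₁ X₀

  v-isLinExt : IsLinExt _≼_ v
  v-isLinExt = proj₂ X₀

  v-sides : Vec Bool (suc m)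
  v-sides = sides v

  v-sides-sorted : Sorted v-sides
  v-sides-sorted with sort-by-swaps (sides (proj₁ someLinExt))
  ... | w , sorted = subst Sorted (sym (sides-applyWord w (proj₁ someLinExt))) sorted

  v-sides-lookup : ∀ i → lookup v-sides i ≡ S (lookup v i)
  v-sides-lookup i = Vec.lookup-map i S v

  side-occurs : ∀ {x} b → S x ≡ b → Any (_≡ b) v-sides
  side-occurs {x} b Sx≡b = map⁺ (Any.map (λ x≡y → trans (cong S (sym x≡y)) Sx≡b) (proj₁ v-isLinExt x))

  no-incomparable-neighbours-on-a-side : ∀ (k : Fin m) → S (lookup v (inject₁ k)) ≡ S (lookup v (suc k)) →
    ¬ Incomparable (lookup v (inject₁ k)) (lookup v (suc k))
  no-incomparable-neighbours-on-a-side k same-side v∥v = sides-W≢sides-Y (hamming≡0⇒≡ _ _ (begin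
    hamming (sides (proj₁ W)) (sides (proj₁ Y)) ≡⟨ sym (hamming-invariant les X₀ Y W Y≢X₀ Y≢W) ⟩
    hamming v-sides (sides (proj₁ Y))          ≡⟨ cong (hamming v-sides) sides-Y ⟩
    hamming v-sides v-sides                    ≡⟨ hamming-refl v-sides ⟩
    0                                          ∎))
    where
    open ≡-Reasoning
    Y = act (toℕ k ∷ []) X₀
    boundary = nonconstant⇒adjacent-≢ v-sides (side-occurs true (proj₂ some-true)) (side-occurs false (proj₂ some-false))
    j = proj₁ boundary
    W = act (toℕ j ∷ []) X₀
    sides-Y : sides (proj₁ Y) ≡ v-sides
    sides-Y = trans (sides-t (toℕ k) v)
      (swapAt-idem k v-sides (trans (v-sides-lookup (inject₁ k)) (trans same-side (sym (v-sides-lookup (suc k))))))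
    sides-W≢sides-Y : sides (proj₁ W) ≢ sides (proj₁ Y)
    sides-W≢sides-Y eq = proj₂ boundary (begin
      lookup v-sides (inject₁ j)                  ≡⟨ cong (λ u → lookup u (inject₁ j)) (sym (trans eq sides-Y)) ⟩
      lookup (sides (proj₁ W)) (inject₁ j)        ≡⟨ cong (λ u → lookup u (inject₁ j)) (sides-t (toℕ j) v) ⟩
      lookup (swapAt (toℕ j) v-sides) (inject₁ j) ≡⟨ swapAt-lookup j v-sides ⟩
      lookup v-sides (suc j)                      ∎)
    Y≢X₀ : proj₁ Y ≢ v
    Y≢X₀ Y≡v = proj₁ v∥v (≼-reflexive (begin
      lookup v (inject₁ k)         ≡⟨ cong (λ u → lookup u (inject₁ k)) (sym Y≡v) ⟩
      lookup (proj₁ Y) (inject₁ k) ≡⟨ t-lookup-incomparable k v v∥v ⟩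
      lookup v (suc k)             ∎))
    Y≢W : proj₁ Y ≢ proj₁ W
    Y≢W Y≡W = sides-W≢sides-Y (cong sides (sym Y≡W))

  -- Around the block, Y reads 1010 and W reads 0101.
  no-1100 : ∀ i → ¬ Has1100At i v-sides
  no-1100 i h = ℕ.0≢1+n (ℕ.suc-injective (ℕ.suc-injective 2≡4))
    where
    Y = act (suc i ∷ []) X₀
    W = act (i ∷ suc (suc i) ∷ suc i ∷ []) X₀
    X₀-Y : hamming v-sides (sides (proj₁ Y)) ≡ 2
    X₀-Y = trans (cong (hamming v-sides) (sides-applyWord (suc i ∷ []) v)) (hamming-1100-1010 h)
    W-Y : hamming (sides (proj₁ W)) (sides (proj₁ Y)) ≡ 4
    W-Y = trans (cong₂ hamming (sides-applyWord (i ∷ suc (suc i) ∷ suc i ∷ []) v) (sides-applyWord (suc i ∷ []) v))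
                (hamming-0101-1010 h)
    2≡4 : 2 ≡ 4
    2≡4 = trans (sym X₀-Y) (trans (hamming-invariant les X₀ Y W
      (hamming≢0⇒≢ v (proj₁ Y) (λ X₀-Y≡0 → ℕ.0≢1+n (trans (sym X₀-Y≡0) X₀-Y)) ∘ sym)
      (hamming≢0⇒≢ (proj₁ W) (proj₁ Y) (λ W-Y≡0 → ℕ.0≢1+n (trans (sym W-Y≡0) W-Y)) ∘ sym)) W-Y)

  sameSide-neighbours-≼ : ∀ (k : Fin m) → S (lookup v (inject₁ k)) ≡ S (lookup v (suc k)) →
    lookup v (inject₁ k) ≼ lookup v (suc k)
  sameSide-neighbours-≼ k same-side with incomparable⊎comparable (lookup v (inject₁ k)) (lookup v (suc k))
  ... | inj₁ a∥b        = ⊥-elim (no-incomparable-neighbours-on-a-side k same-side a∥b)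
  ... | inj₂ (inj₁ a≼b) = a≼b
  ... | inj₂ (inj₂ b≼a) with lookup v (suc k) Fin.≟ lookup v (inject₁ k)
  ...   | yes b≡a = ≼-reflexive (sym b≡a)
  ...   | no b≢a  = ⊥-elim (ℕ.<-asym (proj₂ v-isLinExt (suc k) (inject₁ k) (b≼a , b≢a)) k<1+k)
    where
    k<1+k : toℕ (inject₁ k) < toℕ (suc k)
    k<1+k = s≤s (ℕ.≤-reflexive (Fin.toℕ-inject₁ k))

  position : Fin (suc m) → Fin (suc m)
  position x = Any.index (proj₁ v-isLinExt x)

  lookup-position : ∀ x → lookup v (position x) ≡ x
  lookup-position x = sym (lookup-index (proj₁ v-isLinExt x))

  position-lookup : ∀ k → position (lookup v k) ≡ k
  position-lookup k = linExt-injective v v-isLinExt (lookup-position (lookup v k))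

  module TruesThenFalse (trues : ∀ k → lookup v-sides (inject₁ k) ≡ true)
                        (last-false : lookup v-sides (fromℕ m) ≡ false) where

    true-below : ∀ p → toℕ p < m → S (lookup v p) ≡ true
    true-below p p<m = trans (sym (v-sides-lookup p))
      (subst (λ q → lookup v-sides q ≡ true) (Fin.inject₁-lower₁ p m≢p) (trues (lower₁ p m≢p)))
      where
      m≢p : m ≢ toℕ p
      m≢p m≡p = ℕ.<-irrefl (sym m≡p) p<m

    false-at-m : ∀ p → toℕ p ≡ m → S (lookup v p) ≡ false
    false-at-m p p≡m = trans (cong (S ∘ lookup v) (Fin.toℕ-injective (trans p≡m (sym (Fin.toℕ-fromℕ m)))))
                             (trans (sym (v-sides-lookup (fromℕ m))) last-false)

    ascending : ∀ d p q → toℕ q ≡ d + toℕ p → toℕ q < m → lookup v p ≼ lookup v q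
    ascending zero    p q       q≡p _   = ≼-reflexive (cong (lookup v) (Fin.toℕ-injective (sym q≡p)))
    ascending (suc d) p (suc q) q≡d+p q<m = ≼-trans (ascending d p (inject₁ q) q′≡d+p q′<m) neighbours
      where
      q′≡d+p : toℕ (inject₁ q) ≡ d + toℕ p
      q′≡d+p = trans (Fin.toℕ-inject₁ q) (ℕ.suc-injective q≡d+p)
      q′<m : toℕ (inject₁ q) < m
      q′<m = ℕ.<-trans (s≤s (ℕ.≤-reflexive (Fin.toℕ-inject₁ q))) q<m
      neighbours : lookup v (inject₁ q) ≼ lookup v (suc q)
      neighbours = sameSide-neighbours-≼ q (trans (true-below (inject₁ q) q′<m) (sym (true-below (suc q) q<m)))

    ≼⇒chainPlusPoint : ∀ x y → x ≼ y → ChainPlusPoint m (position x) (position y)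
    ≼⇒chainPlusPoint x y x≼y with x Fin.≟ y
    ... | yes x≡y = inj₁ (cong position x≡y)
    ... | no x≢y  = inj₂ (ℕ.<⇒≤ px<py , py<m)
      where
      px<py : toℕ (position x) < toℕ (position y)
      px<py = proj₂ v-isLinExt (position x) (position y)
                (subst₂ _⊏_ (sym (lookup-position x)) (sym (lookup-position y)) (x≼y , x≢y))
      py<m : toℕ (position y) < m
      py<m = ℕ.≤∧≢⇒< (Fin.toℕ≤pred[n] (position y)) λ py≡m → proj₁ (cross x y
        (trans (cong S (sym (lookup-position x))) (true-below (position x) (subst (toℕ (position x) <_) py≡m px<py)))
        (trans (cong S (sym (lookup-position y))) (false-at-m (position y) py≡m))) x≼y

    chainPlusPoint⇒≼ : ∀ x y → ChainPlusPoint m (position x) (position y) → x ≼ y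
    chainPlusPoint⇒≼ x y (inj₁ px≡py) =
      ≼-reflexive (trans (sym (lookup-position x)) (trans (cong (lookup v) px≡py) (lookup-position y)))
    chainPlusPoint⇒≼ x y (inj₂ (px≤py , py<m)) = subst₂ _≼_ (lookup-position x) (lookup-position y)
      (ascending (toℕ (position y) ∸ toℕ (position x)) (position x) (position y) (sym (ℕ.m∸n+n≡m px≤py)) py<m)

    isChainPlusPoint : IsChainPlusPoint _≼_
    isChainPlusPoint = m , distinct⇒1≤n (proj₁ some-true) (proj₁ some-false) true≢false ,
                       mk↔ₛ′ position (lookup v) position-lookup lookup-position ,
                       λ x y → mk⇔ (≼⇒chainPlusPoint x y) (chainPlusPoint⇒≼ x y)
      where
      true≢false : proj₁ some-true ≢ proj₁ some-false
      true≢false eq = Bool.not-¬ (trans (cong S (sym eq)) (proj₂ some-true)) (proj₂ some-false)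

  module TrueThenFalses (rest-false : ∀ k → lookup v-sides (suc k) ≡ false) (2≤m : 2 ≤ m) where

    only-true : ∀ y → S y ≡ true → y ≡ lookup v zero
    only-true y Sy≡true with position y in py
    ... | zero  = trans (sym (lookup-position y)) (cong (lookup v) py)
    ... | suc k = ⊥-elim (Bool.not-¬ Sy≡true
      (trans (cong S (trans (sym (lookup-position y)) (cong (lookup v) py)))
             (trans (sym (v-sides-lookup (suc k))) (rest-false k))))

    two-falses : ∃₂ λ y₁ y₂ → y₁ ≢ y₂ × S y₁ ≡ false × S y₂ ≡ false
    two-falses with distinct-pair 2≤m
    ... | a , b , a≢b = lookup v (suc a) , lookup v (suc b) ,
                        (λ eq → a≢b (Fin.suc-injective (linExt-injective v v-isLinExt eq))) ,
                        false-at a , false-at b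
      where
      false-at : ∀ k → S (lookup v (suc k)) ≡ false
      false-at k = trans (sym (v-sides-lookup (suc k))) (rest-false k)

  chainPlusPoint⊎lopsided : IsChainPlusPoint _≼_ ⊎ Lopsided S
  chainPlusPoint⊎lopsided with sortedShape v-sides v-sides-sorted
                                 (side-occurs true (proj₂ some-true)) (side-occurs false (proj₂ some-false))
  ... | trues-then-false trues last-false = inj₁ (TruesThenFalse.isChainPlusPoint trues last-false)
  ... | true-then-falses rest-false 2≤m   = inj₂ ((lookup v zero , TrueThenFalses.only-true rest-false 2≤m) ,
                                                  TrueThenFalses.two-falses rest-false 2≤m)
  ... | has-1100 i h                      = ⊥-elim (no-1100 i h)

-- C_m + A_1 is LE-symmetric

module ChainPlusPointLinExts {m : ℕ} (_≼_ : Rel (Fin (suc m)) 0ℓ) (po : IsPartialOrder _≡_ _≼_)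
    (_≼?_ : Decidable _≼_)
    (e : Fin (suc m) ↔ Fin (suc m)) (e-iso : ∀ x y → (x ≼ y) ⇔ ChainPlusPoint m (Inverse.to e x) (Inverse.to e y)) where

  open BenderKnuth _≼_ po _≼?_
  open Inverse e using () renaming
    (to to rank; from to unrank; strictlyInverseˡ to rank-unrank; strictlyInverseʳ to unrank-rank)

  ≼⇒chainPlusPoint : ∀ {x y} → x ≼ y → ChainPlusPoint m (rank x) (rank y)
  ≼⇒chainPlusPoint {x} {y} = Equivalence.to (e-iso x y)

  chainPlusPoint⇒≼ : ∀ {x y} → ChainPlusPoint m (rank x) (rank y) → x ≼ y
  chainPlusPoint⇒≼ {x} {y} = Equivalence.from (e-iso x y)

  isolated : Fin (suc m)
  isolated = unrank (fromℕ m)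

  rank-isolated : toℕ (rank isolated) ≡ m
  rank-isolated = trans (cong toℕ (rank-unrank (fromℕ m))) (Fin.toℕ-fromℕ m)

  rank-injective : ∀ {x y} → rank x ≡ rank y → x ≡ y
  rank-injective {x} {y} eq = trans (sym (unrank-rank x)) (trans (cong unrank eq) (unrank-rank y))

  rank<m : ∀ {x} → x ≢ isolated → toℕ (rank x) < m
  rank<m x≢i = ℕ.≤∧≢⇒< (Fin.toℕ≤pred[n] _)
    (λ eq → x≢i (rank-injective (Fin.toℕ-injective (trans eq (sym rank-isolated)))))

  incomparable-isolated : ∀ x → x ≢ isolated → Incomparable x isolated
  incomparable-isolated x x≢i = x⋠i , i⋠x
    where
    x⋠i : ¬ (x ≼ isolated)
    x⋠i x≼i with ≼⇒chainPlusPoint x≼i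
    ... | inj₁ eq      = x≢i (rank-injective eq)
    ... | inj₂ (_ , i<m) = ℕ.<-irrefl rank-isolated i<m
    i⋠x : ¬ (isolated ≼ x)
    i⋠x i≼x with ≼⇒chainPlusPoint i≼x
    ... | inj₁ eq         = x≢i (sym (rank-injective eq))
    ... | inj₂ (i≤x , x<m) = ℕ.<-irrefl refl (ℕ.≤-<-trans (subst (_≤ toℕ (rank x)) rank-isolated i≤x) x<m)

  comparable-off-isolated : ∀ {x y} → x ≢ isolated → y ≢ isolated → Comparable x y
  comparable-off-isolated {x} {y} x≢i y≢i with ℕ.≤-total (toℕ (rank x)) (toℕ (rank y))
  ... | inj₁ x≤y = inj₁ (chainPlusPoint⇒≼ (inj₂ (x≤y , rank<m y≢i)))
  ... | inj₂ y≤x = inj₂ (chainPlusPoint⇒≼ (inj₂ (y≤x , rank<m x≢i)))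

  sorted : Vec (Fin (suc m)) (suc m)
  sorted = tabulate unrank

  sorted-isLinExt : IsLinExt _≼_ sorted
  sorted-isLinExt = all∈ , respects
    where
    all∈ : ∀ x → x ∈ sorted
    all∈ x = subst (_∈ sorted) (unrank-rank x) (∈-tabulate⁺ unrank (rank x))
    respects : ∀ a b → lookup sorted a ⊏ lookup sorted b → toℕ a < toℕ b
    respects a b ua⊏ub with subst₂ _⊏_ (Vec.lookup∘tabulate unrank a) (Vec.lookup∘tabulate unrank b) ua⊏ub
    ... | ua≼ub , ua≢ub with subst₂ (ChainPlusPoint m) (rank-unrank a) (rank-unrank b) (≼⇒chainPlusPoint ua≼ub)
    ...   | inj₁ a≡b       = ⊥-elim (ua≢ub (cong unrank a≡b))
    ...   | inj₂ (a≤b , _) = ℕ.≤∧≢⇒< a≤b (λ a≡b → ua≢ub (cong unrank (Fin.toℕ-injective a≡b)))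

  isolated-last⇒sorted : (v : Vec (Fin (suc m)) (suc m)) → IsLinExt _≼_ v →
    lookup v (fromℕ m) ≡ isolated → v ≡ sorted
  isolated-last⇒sorted v v-isLinExt v-last = trans (sym (Vec.tabulate∘lookup v)) (Vec.tabulate-cong v≗sorted)
    where
    v-injective = linExt-injective v v-isLinExt
    φ : Fin (suc m) → Fin (suc m)
    φ k = rank (lookup v k)
    φ-increasing : ∀ i j → toℕ i < toℕ j → toℕ (φ i) < toℕ (φ j)
    φ-increasing i j i<j =
      ℕ.≤∧≢⇒< φi≤φj (λ φi≡φj → i≢j (v-injective (rank-injective (Fin.toℕ-injective φi≡φj))))
      where
      i≢j : i ≢ j
      i≢j i≡j = ℕ.<-irrefl (cong toℕ i≡j) i<j
      vi≢i : lookup v i ≢ isolated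
      vi≢i vi≡i = ℕ.<-irrefl refl (ℕ.<-≤-trans i<j (subst (toℕ j ≤_) (sym i≡m) (Fin.toℕ≤pred[n] j)))
        where
        i≡m : toℕ i ≡ m
        i≡m = trans (cong toℕ (v-injective (trans vi≡i (sym v-last)))) (Fin.toℕ-fromℕ m)
      φi≤φj : toℕ (φ i) ≤ toℕ (φ j)
      φi≤φj with ℕ.≤-total (toℕ (φ i)) (toℕ (φ j))
      ... | inj₁ φi≤φj = φi≤φj
      ... | inj₂ φj≤φi = ⊥-elim (ℕ.<-asym i<j (proj₂ v-isLinExt j i
              (chainPlusPoint⇒≼ (inj₂ (φj≤φi , rank<m vi≢i)) , λ vj≡vi → i≢j (sym (v-injective vj≡vi)))))
    v≗sorted : ∀ k → lookup v k ≡ unrank k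
    v≗sorted k = trans (sym (unrank-rank (lookup v k))) (cong unrank (strictlyIncreasing⇒≗id φ φ-increasing k))

  t-moves-isolated : ∀ {k} i (v : Vec (Fin (suc m)) k) (p : Fin k) → lookup v p ≡ isolated →
    (∀ q → lookup v q ≡ isolated → q ≡ p) → lookup (t i v) (adjTranspose i p) ≡ isolated
  t-moves-isolated zero (x ∷ y ∷ xs) zero refl only-p
    rewrite t-incomparable {xs = xs} (swap (incomparable-isolated y (Fin.0≢1+n ∘ sym ∘ only-p (suc zero)))) = refl
  t-moves-isolated zero (x ∷ y ∷ xs) (suc zero) refl only-p
    rewrite t-incomparable {xs = xs} (incomparable-isolated x (Fin.0≢1+n ∘ only-p zero)) = refl
  t-moves-isolated zero (x ∷ y ∷ xs) (suc (suc p)) xs-p only-p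
    rewrite t-comparable {xs = xs} (comparable-off-isolated (Fin.0≢1+n ∘ only-p zero)
                                                            (Fin.0≢1+n ∘ Fin.suc-injective ∘ only-p (suc zero)))
    = xs-p
  t-moves-isolated zero    (x ∷ [])  zero    x≡i only-p = x≡i
  t-moves-isolated (suc i) (x ∷ xs) zero    x≡i only-p = x≡i
  t-moves-isolated (suc i) (x ∷ xs) (suc p) xs-p only-p =
    t-moves-isolated i xs p xs-p (λ q xs-q → Fin.suc-injective (only-p (suc q) xs-q))

  IsolatedAt : LinExt _≼_ → Fin (suc m) → Set
  IsolatedAt X p = lookup (proj₁ X) p ≡ isolated

  act-moves-isolated : ∀ w X p → IsolatedAt X p → IsolatedAt (act w X) (foldr adjTranspose p w)
  act-moves-isolated []      X p X-p = X-p
  act-moves-isolated (i ∷ w) X p X-p = t-moves-isolated i (proj₁ Y) (foldr adjTranspose p w) Y-p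
    (λ q Y-q → linExt-injective (proj₁ Y) (proj₂ Y) (trans Y-q (sym Y-p)))
    where
    Y = act w X
    Y-p = act-moves-isolated w X p X-p

  private
    ≤last : ∀ (j : Fin (suc m)) → toℕ j ≤ toℕ (fromℕ m)
    ≤last j = subst (toℕ j ≤_) (sym (Fin.toℕ-fromℕ m)) (Fin.toℕ≤pred[n] j)

  toLast : Fin (suc m) → List ℕ
  toLast j = proj₁ (bubble-to j (fromℕ m) (≤last j))

  toLast-moves : ∀ j → foldr adjTranspose j (toLast j) ≡ fromℕ m
  toLast-moves j = proj₁ (proj₂ (proj₂ (bubble-to j (fromℕ m) (≤last j))))

  linExtAt : Fin (suc m) → LinExt _≼_
  linExtAt j = act (reverse (toLast j)) (sorted , sorted-isLinExt)

  linExtAt-isolatedAt : ∀ j → IsolatedAt (linExtAt j) j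
  linExtAt-isolatedAt j = subst (IsolatedAt (linExtAt j)) moved-back
    (act-moves-isolated (reverse C) (sorted , sorted-isLinExt) (fromℕ m) (Vec.lookup∘tabulate unrank (fromℕ m)))
    where
    C = toLast j
    moved-back : foldr adjTranspose (fromℕ m) (reverse C) ≡ j
    moved-back = trans (cong (λ p → foldr adjTranspose p (reverse C)) (sym (toLast-moves j)))
                       (foldr-reverse-cancel adjTranspose adjTranspose-involutive C j)

  isolatedAt⇒≡linExtAt : ∀ X p → IsolatedAt X p → proj₁ X ≡ proj₁ (linExtAt p)
  isolatedAt⇒≡linExtAt X p X-p =
    trans (sym (applyWord-reverse-cancel C (proj₁ X))) (cong (applyWord _≼?_ (reverse C)) Y≡sorted)
    where
    C = toLast p
    Y = act C X
    Y≡sorted : proj₁ Y ≡ sorted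
    Y≡sorted = isolated-last⇒sorted (proj₁ Y) (proj₂ Y)
      (subst (IsolatedAt Y) (toLast-moves p) (act-moves-isolated C X p X-p))

  isolatedPosition : LinExt _≼_ → Fin (suc m)
  isolatedPosition X = Any.index (proj₁ (proj₂ X) isolated)

  isolatedAt-position : ∀ X → IsolatedAt X (isolatedPosition X)
  isolatedAt-position X = sym (lookup-index (proj₁ (proj₂ X) isolated))

  isolatedAt-unique : ∀ X {p q} → IsolatedAt X p → IsolatedAt X q → p ≡ q
  isolatedAt-unique X X-p X-q = linExt-injective (proj₁ X) (proj₂ X) (trans X-p (sym X-q))

  isolatedPosition-cong : ∀ X Y → proj₁ X ≡ proj₁ Y → isolatedPosition X ≡ isolatedPosition Y
  isolatedPosition-cong X Y X≡Y = isolatedAt-unique Y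
    (subst (λ u → lookup u (isolatedPosition X) ≡ isolated) X≡Y (isolatedAt-position X)) (isolatedAt-position Y)

  isolatedPosition-linExtAt : ∀ j → isolatedPosition (linExtAt j) ≡ j
  isolatedPosition-linExtAt j = isolatedAt-unique (linExtAt j) (isolatedAt-position (linExtAt j)) (linExtAt-isolatedAt j)

  isLESymmetric : LESymmetric _≼?_
  isLESymmetric σ = w , w-bounded , w-realizes-σ
    where
    open PermLE σ
    π π′ : Fin (suc m) → Fin (suc m)
    π j = isolatedPosition (to (linExtAt j))
    π′ j = isolatedPosition (from (linExtAt j))
    ≡linExtAt : ∀ X → proj₁ X ≡ proj₁ (linExtAt (isolatedPosition X))
    ≡linExtAt X = isolatedAt⇒≡linExtAt X (isolatedPosition X) (isolatedAt-position X)
    ππ′ : StrictlyInverseˡ _≡_ π π′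
    ππ′ j = trans (isolatedPosition-cong (to (linExtAt (π′ j))) (linExtAt j)
                    (trans (to-cong _ _ (sym (≡linExtAt (from (linExtAt j))))) (to-from (linExtAt j))))
                  (isolatedPosition-linExtAt j)
    π′π : StrictlyInverseʳ _≡_ π π′
    π′π j = trans (isolatedPosition-cong (from (linExtAt (π j))) (linExtAt j)
                    (trans (from-cong _ _ (sym (≡linExtAt (to (linExtAt j))))) (from-to (linExtAt j))))
                  (isolatedPosition-linExtAt j)
    realization = adjTransposes-realize π π′ ππ′ π′π
    w = proj₁ realization
    w-bounded = proj₁ (proj₂ realization)
    w-realizes-σ : ∀ X → applyWord _≼?_ w (proj₁ X) ≡ proj₁ (to X)
    w-realizes-σ X = begin
      applyWord _≼?_ w (proj₁ X) ≡⟨ isolatedAt⇒≡linExtAt (act w X) (π p) wX-at-πp ⟩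
      proj₁ (linExtAt (π p))     ≡⟨ sym (≡linExtAt (to (linExtAt p))) ⟩
      proj₁ (to (linExtAt p))    ≡⟨ to-cong (linExtAt p) X (sym (≡linExtAt X)) ⟩
      proj₁ (to X)               ∎
      where
      open ≡-Reasoning
      p = isolatedPosition X
      wX-at-πp : IsolatedAt (act w X) (π p)
      wX-at-πp = subst (IsolatedAt (act w X)) (proj₂ (proj₂ realization) p)
                       (act-moves-isolated w X p (isolatedAt-position X))

Fin-↔⇒≡ : ∀ {m n} → Fin m ↔ Fin n → m ≡ n
Fin-↔⇒≡ e = Fin.cantor-schröder-bernstein (Injection.injective (↔⇒↣ e)) (Injection.injective (↔⇒↣ (↔-sym e)))

chainPlusPoint⇒LESymmetric : ∀ {n} (_≼_ : Rel (Fin n) 0ℓ) → IsPartialOrder _≡_ _≼_ → (_≼?_ : Decidable _≼_) →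
  IsChainPlusPoint _≼_ → LESymmetric _≼?_
chainPlusPoint⇒LESymmetric _≼_ po _≼?_ (m , _ , e , e-iso) with Fin-↔⇒≡ e
... | refl = ChainPlusPointLinExts.isLESymmetric _≼_ po _≼?_ e e-iso

disconnected-LESymmetric⇒chainPlusPoint : ∀ {n} (_≼_ : Rel (Fin n) 0ℓ) → IsPartialOrder _≡_ _≼_ →
  (_≼?_ : Decidable _≼_) → Disconnected _≼_ → LESymmetric _≼?_ → IsChainPlusPoint _≼_
disconnected-LESymmetric⇒chainPlusPoint {zero} _ _ _ (_ , (() , _) , _) _
disconnected-LESymmetric⇒chainPlusPoint {suc m} _≼_ po _≼?_ (S , (x , Sx) , (y , Sy) , cross) les
  with SortedLinExt.chainPlusPoint⊎lopsided _≼_ po _≼?_ S cross les (x , Sx) (y , Sy)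
     | SortedLinExt.chainPlusPoint⊎lopsided _≼_ po _≼?_ (not ∘ S) (separates-not cross) les
                                             (y , cong not Sy) (x , cong not Sx)
... | inj₁ chain+point | _                = chain+point
... | inj₂ _           | inj₁ chain+point = chain+point
... | inj₂ ((_ , only-true) , _) | inj₂ (_ , y₁ , y₂ , y₁≢y₂ , ¬Sy₁≡false , ¬Sy₂≡false) =
  ⊥-elim (y₁≢y₂ (trans (only-true y₁ (Bool.not-injective ¬Sy₁≡false))
                       (sym (only-true y₂ (Bool.not-injective ¬Sy₂≡false)))))

theorem4p12 : (n : ℕ) (_≼_ : Rel (Fin n) 0ℓ) → IsPartialOrder _≡_ _≼_ →
    (_≼?_ : Decidable _≼_) → Disconnected _≼_ →
    (LESymmetric _≼?_ ⇔ IsChainPlusPoint _≼_)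
theorem4p12 n _≼_ po _≼?_ disconnected =
  mk⇔ (disconnected-LESymmetric⇒chainPlusPoint _≼_ po _≼?_ disconnected) (chainPlusPoint⇒LESymmetric _≼_ po _≼?_)
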